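{- Let $(L,\wedge,\vee)$ be a non-empty lattice equipped with a unary operation $x\mapsto x^{\triangle}$ such that for all $x,y\in L$: (1) $x^{\triangle\triangle}\le x$; (2) $x\le y$ implies $x^{\triangle}\ge y^{\triangle}$; (3) $(x\wedge y)\vee(x\wedge y^{\triangle})=x$. Then $L$ is bounded, i.e. it has a least element $0$ and a greatest element $1$. Consequently the weakly complemented lattices are exactly the non-empty lattices with a unary operation satisfying (1)--(3).
   Context: A weakly complemented lattice is a bounded lattice $(L,\wedge,\vee,0,1)$ together with a unary operation $x\mapsto x^{\triangle}$ satisfying, for all $x,y\in L$: (1) $x^{\triangle\triangle}\le x$; (2) $x\le y\implies x^{\triangle}\ge y^{\triangle}$; (3) $(x\wedge y)\vee(x\wedge y^{\triangle})=x$. Here $x^{\triangle\triangle}$ means $(x^{\triangle})^{\triangle}$. -}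

module Defs where

open import Level using (_⊔_)
open import Relation.Binary.Lattice using (Lattice)

record IsWeakComplementOp {c ℓ₁ ℓ₂} (L : Lattice c ℓ₁ ℓ₂)
       (△ : Lattice.Carrier L → Lattice.Carrier L) : Set (c ⊔ ℓ₁ ⊔ ℓ₂) where
  open Lattice L
  field
    △△-≤ : ∀ x → △ (△ x) ≤ x
    △-antitone : ∀ x y → x ≤ y → △ y ≤ △ x
    split : ∀ x y → ((x ∧ y) ∨ (x ∧ △ y)) ≈ x

module Submission where

open import Defs
open import Data.Product using (Σ; _×_; _,_)
open import Relation.Binary.Lattice using (Lattice)
open import Relation.Binary.Lattice.Properties.JoinSemilattice using (∨-monotonic)
open import Relation.Binary.Definitions using (Minimum; Maximum)

-- Axiom (3) writes x as a join of a part below a and a part below △ a, so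
-- a ∨ △ a is the top for any a; by (2) and (1), △ of the top lies below
-- △ (△ x) ≤ x for every x, so it is the bottom.
module WeakComplement {c ℓ₁ ℓ₂} (L : Lattice c ℓ₁ ℓ₂)
       {△ : Lattice.Carrier L → Lattice.Carrier L} (W : IsWeakComplementOp L △) where

  open Lattice L
  open IsWeakComplementOp W

  ∨-△-maximum : ∀ a → Maximum _≤_ (a ∨ △ a)
  ∨-△-maximum a x = trans (reflexive (Eq.sym (split x a)))
    (∨-monotonic joinSemilattice (x∧y≤y x a) (x∧y≤y x (△ a)))

  △-maximum⇒minimum : ∀ {o} → Maximum _≤_ o → Minimum _≤_ (△ o)
  △-maximum⇒minimum top x = trans (△-antitone (△ x) _ (top (△ x))) (△△-≤ x)

theorem1 : ∀ {c ℓ₁ ℓ₂} (L : Lattice c ℓ₁ ℓ₂) → Lattice.Carrier L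
    → (△ : Lattice.Carrier L → Lattice.Carrier L) → IsWeakComplementOp L △
    → Σ (Lattice.Carrier L) (λ z → Minimum (Lattice._≤_ L) z)
    × Σ (Lattice.Carrier L) (λ o → Maximum (Lattice._≤_ L) o)
theorem1 L a △ W = (△ (a ∨ △ a) , △-maximum⇒minimum (∨-△-maximum a))
                 , (a ∨ △ a , ∨-△-maximum a)
  where
  open Lattice L using (_∨_)
  open WeakComplement L W
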